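{- Let $x\ge2$ and $n\ge1$ be integers and let $L$ be a multiset of size $n-1$ having a standard linear realization $P$ (a Hamiltonian path in $K_n$). Suppose that for some integers $0\le k<x$ and $0\le s_1\le s_2$ with $s_2x+k\le n-1$, the last $w+1$ vertices of $P$, where $w=s_2-s_1$, are $s_1x+k,(s_1+1)x+k,\dots,s_2x+k$ in this order or in the reverse order. Let $M$ be a multiset of size $w$ that has a standard linear realization. Then $(L\setminus\{x^w\})\cup xM$ has a standard linear realization.
   Context: $K_n$ is the complete graph on vertex set $\{0,\dots,n-1\}$; the linear length of an edge $\{u,w\}$ is $|u-w|$. A multiset of size $n-1$ has a linear realization if some Hamiltonian path in $K_n$ has multiset of linear edge lengths equal to it; it is standard if the path starts at $0$. $\{x^w\}$ is the multiset consisting of $x$ with multiplicity $w$; $\setminus$ and $\cup$ are multiset difference and union; $xM=\{xm: m\in M\}$ (with multiplicities). -}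

module Defs where

open import Data.Nat using (ℕ; zero; suc; _+_; _*_; ∣_-_∣; _≟_)
open import Data.List using (List; []; _∷_; upTo; length)
open import Data.List.Relation.Binary.Permutation.Propositional using (_↭_)
open import Data.Product using (Σ; ∃; _×_)
open import Relation.Binary.PropositionalEquality using (_≡_)
open import Relation.Nullary using (yes; no)

-- Multisets of naturals are represented by lists, compared up to permutation (_↭_).

lengths : List ℕ → List ℕ
lengths (u ∷ v ∷ p) = ∣ u - v ∣ ∷ lengths (v ∷ p)
lengths _ = []

IsHamPath : ℕ → List ℕ → Set
IsHamPath n P = P ↭ upTo n

IsLinReal : ℕ → List ℕ → List ℕ → Set
IsLinReal n L P = IsHamPath n P × lengths P ↭ L

IsStdLinReal : ℕ → List ℕ → List ℕ → Set
IsStdLinReal n L P = IsLinReal n L P × ∃ λ rest → P ≡ 0 ∷ rest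

HasStdLinReal : List ℕ → Set
HasStdLinReal L = ∃ λ P → IsStdLinReal (suc (length L)) L P

removeOne : ℕ → List ℕ → List ℕ
removeOne x [] = []
removeOne x (y ∷ ys) with x ≟ y
... | yes _ = ys
... | no _ = y ∷ removeOne x ys

removeN : ℕ → ℕ → List ℕ → List ℕ
removeN zero x L = L
removeN (suc w) x L = removeN w x (removeOne x L)

{-# OPTIONS --safe #-}
module Submission where

-- The last w + 1 vertices of P form an arithmetic progression h 0, …, h w
-- with difference x, so they contribute w edges of length x. Replace them
-- by h Q₀, …, h Q_w for a standard realization Q of M in K_{w+1}: the vertex
-- set is unchanged, the edge into the block still ends at h 0 = h Q₀, and
-- since h multiplies distances by x the block now contributes xM.

open import Defs
open import Data.Nat using (ℕ; zero; suc; _+_; _*_; _∸_; _≤_; _<_; ∣_-_∣; _≟_; s≤s; z<s; s<s)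
open import Data.Nat.Properties
open import Data.List using (List; []; _∷_; _++_; [_]; map; upTo; applyUpTo; applyDownFrom; reverse; length; replicate)
open import Data.List.Properties using (map-upTo; reverse-applyUpTo; ∷-injectiveˡ)
open import Data.List.Relation.Unary.All using (All; []; _∷_)
open import Data.List.Relation.Unary.All.Properties using (all-upTo)
open import Data.List.Relation.Unary.Any using (here; there)
open import Data.List.Membership.Propositional using (_∈_)
open import Data.List.Relation.Binary.Permutation.Propositional
  using (_↭_; ↭-refl; ↭-sym; ↭-trans; ↭-prep; ↭-swap; ↭-reflexive)
open import Data.List.Relation.Binary.Permutation.Propositional.Properties
  using (++⁺ˡ; ++⁺ʳ; ++-identityʳ; map⁺; drop-∷; shift; All-resp-↭; ∈-resp-↭)
open import Data.Product using (∃; _,_)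
open import Data.Sum using (_⊎_; inj₁; inj₂)
open import Data.Empty using (⊥-elim)
open import Relation.Binary.PropositionalEquality hiding ([_])
open import Relation.Nullary using (yes; no)
open import Function using (_∘′_)

removeOne-↭ : ∀ {x} L → x ∈ L → L ↭ x ∷ removeOne x L
removeOne-↭ {x} (y ∷ ys) x∈L with x ≟ y
... | yes refl = ↭-refl
removeOne-↭ (y ∷ ys) (here x≡y)  | no x≢y = ⊥-elim (x≢y x≡y)
removeOne-↭ (y ∷ ys) (there x∈ys) | no _ =
  ↭-trans (↭-prep y (removeOne-↭ ys x∈ys)) (↭-swap y _ ↭-refl)

removeN-↭ : ∀ w x L B → L ↭ B ++ replicate w x → removeN w x L ↭ B
removeN-↭ zero    x L B L↭ = ↭-trans L↭ (++-identityʳ B)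
removeN-↭ (suc w) x L B L↭ =
  removeN-↭ w x (removeOne x L) B (drop-∷ (↭-trans (↭-sym L↭x∷rest) L↭x∷B))
  where
  L↭x∷B : L ↭ x ∷ (B ++ replicate w x)
  L↭x∷B = ↭-trans L↭ (shift x B (replicate w x))

  L↭x∷rest : L ↭ x ∷ removeOne x L
  L↭x∷rest = removeOne-↭ L (∈-resp-↭ (↭-sym L↭x∷B) (here refl))

lengths-++-∷ : ∀ pre (a : ℕ) r → lengths (pre ++ a ∷ r) ≡ lengths (pre ++ [ a ]) ++ lengths (a ∷ r)
lengths-++-∷ []          a r = refl
lengths-++-∷ (u ∷ [])    a r = refl
lengths-++-∷ (u ∷ v ∷ l) a r = cong (∣ u - v ∣ ∷_) (lengths-++-∷ (v ∷ l) a r)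

ScalesBy : ℕ → (ℕ → ℕ) → (ℕ → Set) → Set
ScalesBy d h P = ∀ {a b} → P a → P b → ∣ h a - h b ∣ ≡ d * ∣ a - b ∣

lengths-map-scaling : ∀ d {h P} → ScalesBy d h P →
  ∀ {l} → All P l → lengths (map h l) ≡ map (d *_) (lengths l)
lengths-map-scaling d h-scales []             = refl
lengths-map-scaling d h-scales (_ ∷ [])       = refl
lengths-map-scaling d h-scales (pa ∷ pb ∷ pl) =
  cong₂ _∷_ (h-scales pa pb) (lengths-map-scaling d h-scales (pb ∷ pl))

lengths-applyUpTo-constant : ∀ f w {d} → (∀ {i} → i < w → ∣ f i - f (suc i) ∣ ≡ d) →
  lengths (applyUpTo f (suc w)) ≡ replicate w d
lengths-applyUpTo-constant f zero    steps = refl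
lengths-applyUpTo-constant f (suc w) steps =
  cong₂ _∷_ (steps z<s) (lengths-applyUpTo-constant (f ∘′ suc) w (steps ∘′ s<s))

∣n-1+n∣≡1 : ∀ n → ∣ n - suc n ∣ ≡ 1
∣n-1+n∣≡1 zero    = refl
∣n-1+n∣≡1 (suc n) = ∣n-1+n∣≡1 n

lengths-map-upTo-scaling : ∀ {x h} w → ScalesBy x h (_< suc w) →
  lengths (map h (upTo (suc w))) ≡ replicate w x
lengths-map-upTo-scaling {x} {h} w h-scales = begin
  lengths (map h (upTo (suc w)))    ≡⟨ cong lengths (map-upTo h (suc w)) ⟩
  lengths (applyUpTo h (suc w))     ≡⟨ lengths-applyUpTo-constant h w step ⟩
  replicate w x                     ∎
  where
  open ≡-Reasoning
  step : ∀ {i} → i < w → ∣ h i - h (suc i) ∣ ≡ x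
  step {i} i<w = begin
    ∣ h i - h (suc i) ∣  ≡⟨ h-scales (m<n⇒m<1+n i<w) (s<s i<w) ⟩
    x * ∣ i - suc i ∣    ≡⟨ cong (x *_) (∣n-1+n∣≡1 i) ⟩
    x * 1                ≡⟨ *-identityʳ x ⟩
    x                    ∎

++-∷-head : ∀ pre {a b : ℕ} {r r′ t} → pre ++ a ∷ r ≡ b ∷ t → ∃ λ t′ → pre ++ a ∷ r′ ≡ b ∷ t′
++-∷-head []        {r′ = r′} eq = r′ , cong (_∷ r′) (∷-injectiveˡ eq)
++-∷-head (_ ∷ pre) {a} {r′ = r′} eq = pre ++ a ∷ r′ , cong (_∷ pre ++ a ∷ r′) (∷-injectiveˡ eq)

IsStdLinReal-substitute : ∀ {n w x L M Q} pre h → ScalesBy x h (_< suc w) →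
  IsStdLinReal n L (pre ++ map h (upTo (suc w))) → IsStdLinReal (suc w) M Q →
  IsStdLinReal n (removeN w x L ++ map (x *_) M) (pre ++ map h Q)
IsStdLinReal-substitute {n} {w} {x} {L} {M} pre h h-scales
  ((P-ham , P-lengths) , (_ , P-starts)) ((Q-ham , Q-lengths) , (R , refl)) =
  (hamiltonian , ↭-trans (↭-reflexive new-lengths) lengths↭) , ++-∷-head pre P-starts
  where
  open ≡-Reasoning
  B = lengths (pre ++ [ h 0 ])

  hamiltonian : pre ++ map h (0 ∷ R) ↭ upTo n
  hamiltonian = ↭-trans (++⁺ˡ pre (map⁺ h Q-ham)) P-ham

  old-lengths : lengths (pre ++ map h (upTo (suc w))) ≡ B ++ replicate w x
  old-lengths = begin
    lengths (pre ++ map h (upTo (suc w)))   ≡⟨ lengths-++-∷ pre (h 0) _ ⟩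
    B ++ lengths (map h (upTo (suc w)))     ≡⟨ cong (B ++_) (lengths-map-upTo-scaling w h-scales) ⟩
    B ++ replicate w x                      ∎

  new-lengths : lengths (pre ++ map h (0 ∷ R)) ≡ B ++ map (x *_) (lengths (0 ∷ R))
  new-lengths = begin
    lengths (pre ++ map h (0 ∷ R))          ≡⟨ lengths-++-∷ pre (h 0) (map h R) ⟩
    B ++ lengths (map h (0 ∷ R))            ≡⟨ cong (B ++_) (lengths-map-scaling x h-scales
                                                 (All-resp-↭ (↭-sym Q-ham) (all-upTo (suc w)))) ⟩
    B ++ map (x *_) (lengths (0 ∷ R))       ∎

  B↭ : B ↭ removeN w x L
  B↭ = ↭-sym (removeN-↭ w x L B (↭-trans (↭-sym P-lengths) (↭-reflexive old-lengths)))

  lengths↭ : B ++ map (x *_) (lengths (0 ∷ R)) ↭ removeN w x L ++ map (x *_) M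
  lengths↭ = ↭-trans (++⁺ˡ B (map⁺ (x *_) Q-lengths)) (++⁺ʳ (map (x *_) M) B↭)

affine-scales : ∀ c k x a b → ∣ (c + a) * x + k - (c + b) * x + k ∣ ≡ x * ∣ a - b ∣
affine-scales c k x a b = begin
  ∣ (c + a) * x + k - (c + b) * x + k ∣
    ≡⟨ cong₂ ∣_-_∣ (+-comm ((c + a) * x) k) (+-comm ((c + b) * x) k) ⟩
  ∣ k + (c + a) * x - k + (c + b) * x ∣
    ≡⟨ ∣m+n-m+o∣≡∣n-o∣ k ((c + a) * x) ((c + b) * x) ⟩
  ∣ (c + a) * x - (c + b) * x ∣
    ≡⟨ cong₂ ∣_-_∣ (*-distribʳ-+ x c a) (*-distribʳ-+ x c b) ⟩
  ∣ c * x + a * x - c * x + b * x ∣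
    ≡⟨ ∣m+n-m+o∣≡∣n-o∣ (c * x) (a * x) (b * x) ⟩
  ∣ a * x - b * x ∣
    ≡⟨ sym (*-distribʳ-∣-∣ x a b) ⟩
  ∣ a - b ∣ * x
    ≡⟨ *-comm ∣ a - b ∣ x ⟩
  x * ∣ a - b ∣ ∎
  where open ≡-Reasoning

reflection-isometry : ∀ w {a b} → a ≤ w → b ≤ w → ∣ w ∸ a - w ∸ b ∣ ≡ ∣ a - b ∣
reflection-isometry w       {zero}  {b}     _         b≤w       =
  trans (m≤n⇒∣n-m∣≡n∸m (m∸n≤m w b)) (m∸[m∸n]≡n b≤w)
reflection-isometry w       {suc a} {zero}  a≤w       _         =
  trans (m≤n⇒∣m-n∣≡n∸m (m∸n≤m w (suc a))) (m∸[m∸n]≡n a≤w)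
reflection-isometry (suc w) {suc a} {suc b} (s≤s a≤w) (s≤s b≤w) = reflection-isometry w a≤w b≤w

applyDownFrom-suc : ∀ (f : ℕ → ℕ) w → applyDownFrom f (suc w) ≡ applyUpTo (λ i → f (w ∸ i)) (suc w)
applyDownFrom-suc f zero    = refl
applyDownFrom-suc f (suc w) = cong (f (suc w) ∷_) (applyDownFrom-suc f w)

reverse-map-upTo : ∀ (f : ℕ → ℕ) w → reverse (map f (upTo (suc w))) ≡ map (λ i → f (w ∸ i)) (upTo (suc w))
reverse-map-upTo f w = begin
  reverse (map f (upTo (suc w)))              ≡⟨ cong reverse (map-upTo f (suc w)) ⟩
  reverse (applyUpTo f (suc w))               ≡⟨ reverse-applyUpTo f (suc w) ⟩
  applyDownFrom f (suc w)                     ≡⟨ applyDownFrom-suc f w ⟩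
  applyUpTo (λ i → f (w ∸ i)) (suc w)         ≡⟨ map-upTo (λ i → f (w ∸ i)) (suc w) ⟨
  map (λ i → f (w ∸ i)) (upTo (suc w))        ∎
  where open ≡-Reasoning

lemma4p1 : (x n : ℕ) → 2 ≤ x → 1 ≤ n →
    (L P : List ℕ) → length L ≡ n ∸ 1 → IsStdLinReal n L P →
    (k s₁ s₂ : ℕ) → k < x → s₁ ≤ s₂ → s₂ * x + k ≤ n ∸ 1 →
    (∃ λ pre → P ≡ pre ++ map (λ i → (s₁ + i) * x + k) (upTo (suc (s₂ ∸ s₁)))
      ⊎ P ≡ pre ++ reverse (map (λ i → (s₁ + i) * x + k) (upTo (suc (s₂ ∸ s₁))))) →
    (M : List ℕ) → length M ≡ s₂ ∸ s₁ → HasStdLinReal M →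
    ∃ λ Q → IsStdLinReal n (removeN (s₂ ∸ s₁) x L ++ map (x *_) M) Q
lemma4p1 x n _ _ L P _ P-real k s₁ s₂ _ _ _ (pre , P≡) M |M| (Q , Q-real) = substitute P≡
  where
  w = s₂ ∸ s₁

  f : ℕ → ℕ
  f i = (s₁ + i) * x + k

  Q-real′ : IsStdLinReal (suc w) M Q
  Q-real′ = subst (λ m → IsStdLinReal (suc m) M Q) |M| Q-real

  reflected-scales : ScalesBy x (λ i → f (w ∸ i)) (_< suc w)
  reflected-scales (s≤s a≤w) (s≤s b≤w) =
    trans (affine-scales s₁ k x _ _) (cong (x *_) (reflection-isometry w a≤w b≤w))

  substitute : P ≡ pre ++ map f (upTo (suc w)) ⊎ P ≡ pre ++ reverse (map f (upTo (suc w))) →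
    ∃ λ Q′ → IsStdLinReal n (removeN w x L ++ map (x *_) M) Q′
  substitute (inj₁ refl) =
    _ , IsStdLinReal-substitute pre f (λ _ _ → affine-scales s₁ k x _ _) P-real Q-real′
  substitute (inj₂ refl) =
    _ , IsStdLinReal-substitute pre (λ i → f (w ∸ i)) reflected-scales
          (subst (IsStdLinReal n L) (cong (pre ++_) (reverse-map-upTo f w)) P-real) Q-real′
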